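{- Let $A_1=\{231,312,4321,21543\}$. For every positive integer $n$ and every integer $k\ge 3$, the number of permutations in $\operatorname{Av}_n(A_1)$ with exactly $k$ inversions is $$\binom{n-k}{k}+\sum_{\ell=k-3}^{n-3}\binom{\ell-(k-3)}{k-3}=\binom{n-k}{k}+\binom{n-k+1}{k-2}.$$
   Context: $\operatorname{Av}_n(S)$ is the set of permutations of length $n$ avoiding every pattern in $S$ (classical pattern avoidance). An inversion of a permutation $\pi$ is a pair of positions $i<j$ with $\pi_i>\pi_j$. Binomial coefficients $\binom{a}{b}$ with integer arguments are taken to be $0$ unless $0\le b\le a$; empty sums are $0$. -}

module Defs where

open import Data.Bool using (Bool; true; false; _∧_; _∨_; not)
open import Data.Nat using (ℕ; zero; suc; _+_; _∸_; _<ᵇ_; _≡ᵇ_)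
open import Data.Nat.Combinatorics using (_C_)
open import Data.Fin using (Fin; toℕ)
open import Data.List using (List; []; _∷_; map; length; filterᵇ; upTo; concatMap; allFin; zip; _++_)
open import Data.Vec using (Vec; toList)
import Data.Vec
open import Data.Bool.ListAction using (all; any)
open import Data.Nat.ListAction using (sum)
open import Data.Product using (_,_)

-- A permutation-candidate of length n is a word  Fin n → ... stored as Vec (Fin n) n;
-- values are read as natural numbers 0..n-1 (relative order is all that matters).
word : ∀ {n} → Vec (Fin n) n → List ℕ
word v = map toℕ (toList v)

allVecs : (m n : ℕ) → List (Vec (Fin n) m)
allVecs zero    n = Data.Vec.[] ∷ []
allVecs (suc m) n = concatMap (λ i → map (λ v → i Data.Vec.∷ v) (allVecs m n)) (allFin n)

_≢ᵇ_ : ℕ → ℕ → Bool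
x ≢ᵇ y = not (x ≡ᵇ y)

distinct : List ℕ → Bool
distinct []       = true
distinct (x ∷ xs) = all (x ≢ᵇ_) xs ∧ distinct xs

-- a vector in Fin n of length n with distinct entries is exactly a permutation of length n
isPerm : ∀ {n} → Vec (Fin n) n → Bool
isPerm v = distinct (word v)

inv : List ℕ → ℕ
inv []       = 0
inv (x ∷ xs) = length (filterᵇ (λ y → y <ᵇ x) xs) + inv xs

subseqs : {A : Set} → List A → List (List A)
subseqs []       = [] ∷ []
subseqs (x ∷ xs) = map (x ∷_) (subseqs xs) ++ subseqs xs

_⇔ᵇ_ : Bool → Bool → Bool
true  ⇔ᵇ b = b
false ⇔ᵇ b = not b

orderIso : List ℕ → List ℕ → Bool
orderIso []       []       = true
orderIso []       (_ ∷ _)  = false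
orderIso (_ ∷ _)  []       = false
orderIso (x ∷ xs) (y ∷ ys) =
  all (λ { (x' , y') → (x <ᵇ x') ⇔ᵇ (y <ᵇ y') }) (zip xs ys) ∧ orderIso xs ys

contains : List ℕ → List ℕ → Bool
contains π p = any (orderIso p) (subseqs π)

avoidsAll : List (List ℕ) → List ℕ → Bool
avoidsAll S π = all (λ p → not (contains π p)) S

A₁ : List (List ℕ)
A₁ = (2 ∷ 3 ∷ 1 ∷ []) ∷ (3 ∷ 1 ∷ 2 ∷ []) ∷ (4 ∷ 3 ∷ 2 ∷ 1 ∷ [])
   ∷ (2 ∷ 1 ∷ 5 ∷ 4 ∷ 3 ∷ []) ∷ []

countAvInv : List (List ℕ) → ℕ → ℕ → ℕ
countAvInv S n k =
  length (filterᵇ (λ v → isPerm v ∧ avoidsAll S (word v) ∧ (inv (word v) ≡ᵇ k)) (allVecs n n))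

-- Σ_{ℓ = a}^{n-3} f ℓ  (empty when n - 3 < a, including n < 3)
sumToNminus3 : ℕ → ℕ → (ℕ → ℕ) → ℕ
sumToNminus3 a n f = sum (map f (filterᵇ (λ ℓ → not (ℓ <ᵇ a)) (upTo (n ∸ 2))))

{-# OPTIONS --safe #-}
module Submission where

-- Av(231, 312) consists of the layered permutations: increasing sequences of layers, each a decreasing
-- run of consecutive values. Avoiding 4321 bounds the layers by 3 entries, and since 21543 = 21 ⊕ 321, a
-- layer of size 3 may only follow layers of size 1. A layer of size 2 carries one inversion and one of
-- size 3 carries three, so the avoiders with k inversions and no layer of size 3 are the compositions of
-- n with k parts 2 and n − 2k parts 1, counted by C(n − k, k); those whose layer of size 3 is followed by
-- ℓ more entries number C(ℓ − (k − 3), k − 3), and the hockey-stick identity sums these.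

open import Data.Bool using (Bool; true; false; T; T?; not; _∧_; if_then_else_)
open import Data.Bool.Properties using (T-∧)
open import Data.Empty using (⊥; ⊥-elim)
open import Data.Unit using (⊤)
open import Data.Product using (∃; ∃₂; _×_; _,_; proj₁; proj₂)
open import Data.Sum using (_⊎_; inj₁; inj₂)
open import Data.Maybe using (just)
open import Data.Maybe.Properties using (just-injective)
open import Data.Maybe.Relation.Unary.All using (just)
import Data.Maybe.Relation.Unary.All as Maybe
open import Data.Nat using (ℕ; zero; suc; _+_; _∸_; _<_; _≤_; _>_; _≥_; _<ᵇ_; _≡ᵇ_; _<?_; _≤?_; s≤s; z≤n)
open import Data.Nat.Properties using (<ᵇ⇒<; <⇒<ᵇ; ≮⇒≥; <⇒≱; m≢1+n+m; 1+n≢n; ≤-trans; ≤-reflexive; <-≤-trans;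
  <-irrefl; <-asym; <⇒≢; >⇒≢; ≤-<-trans; ≤-refl; ≤-pred; m≤n+m; m<n⇒m<1+n; +-monoˡ-≤; +-cancelʳ-≤; m≤m+n;
  +-assoc; +-comm; <⇒≤; <-trans; m∸n+n≡m; +-cancelʳ-<; ≤∧≢⇒<; ≤-antisym; +-monoʳ-≤; m≤n⇒∃[o]m+o≡n;
  +-cancelˡ-≡; n<1+n; n≤1+n; suc-injective; ≡ᵇ⇒≡; ≡⇒≡ᵇ; +-identityʳ; +-∸-assoc; m≤n⇒m∸n≡0; ≰⇒>; 0∸n≡0;
  ∸-+-assoc)
open import Data.Nat.Induction using (<-wellFounded)
open import Data.Nat.Combinatorics using (_C_; nCk+nC[k+1]≡[n+1]C[k+1]; k>n⇒nCk≡0)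
open import Data.Nat.ListAction using (sum)
open import Data.Nat.ListAction.Properties using (sum-++)
open import Data.Nat.Solver using (module +-*-Solver)
open import Data.Fin using (Fin; toℕ; fromℕ<)
open import Data.Fin.Properties using (toℕ-injective; toℕ<n; toℕ-fromℕ<)
open import Data.Vec using (Vec; []; _∷_; toList)
import Data.Vec.Properties as Vec
open import Data.List using (List; []; _∷_; _++_; map; length; zip; filterᵇ; head; applyUpTo; upTo; takeWhile;
  dropWhile; concatMap; cartesianProductWith; allFin)
open import Data.List.Properties using (++-cancelˡ; length-++; length-applyUpTo; takeWhile++dropWhile;
  ∷-injective; filter-++; filter-none; filter-all; filter-accept; filter-reject; ++-identityʳ; map-++;
  upTo-∷ʳ)
open import Data.List.Membership.Propositional using (_∈_; find; lose)
open import Data.List.Membership.Propositional.Properties using (∈-map⁺; ∈-map⁻; ∈-++⁺ˡ; ∈-++⁺ʳ; ∈-++⁻; ∈-∃++;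
  ∈-applyUpTo⁺; ∈-concatMap⁺; ∈-allFin; ∈-filter⁺; ∈-filter⁻)
open import Data.List.Membership.Propositional.Properties.WithK using (unique∧set⇒bag)
open import Data.List.Relation.Unary.Any using (here; there)
open import Data.List.Relation.Unary.Any.Properties using (any⁺; any⁻)
open import Data.List.Relation.Unary.All using (All; []; _∷_)
import Data.List.Relation.Unary.All as All
open import Data.List.Relation.Unary.All.Properties using (all⁺; all⁻; all-takeWhile; all-head-dropWhile)
import Data.List.Relation.Unary.All.Properties as All
open import Data.List.Relation.Unary.AllPairs using (AllPairs; []; _∷_)
import Data.List.Relation.Unary.AllPairs as AllPairs
import Data.List.Relation.Unary.AllPairs.Properties as AllPairs
open import Data.List.Relation.Unary.Unique.Propositional using (Unique)
import Data.List.Relation.Unary.Unique.Propositional.Properties as Unique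
open import Data.List.Relation.Binary.Sublist.Propositional using (_⊆_; []; _∷_; _∷ʳ_; ⊆-refl; ⊆-trans; from∈;
  minimum)
open import Data.List.Relation.Binary.Sublist.Propositional.Properties using (All-resp-⊆; ++⁺ˡ; ++⁺ʳ; ++⁺)
open import Data.List.Relation.Binary.Permutation.Propositional.Properties using (↭-length; shift; ∈-resp-↭)
open import Data.List.Relation.Binary.BagAndSetEquality using (∼bag⇒↭)
open import Function using (_∘_; Equivalence; _⇔_; mk⇔)
open import Induction.WellFounded using (Acc; acc)
open import Relation.Binary.PropositionalEquality using (_≡_; _≢_; refl; cong; cong₂; sym; trans; subst;
  ≢-sym; module ≡-Reasoning)
open import Relation.Nullary using (¬_; yes; no)

open import Defs

open Equivalence using (to; from)

T-not⁺ : ∀ {b} → ¬ T b → T (not b)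
T-not⁺ {false} _ = _
T-not⁺ {true} ¬t = ¬t _

T-not⁻ : ∀ {b} → T (not b) → ¬ T b
T-not⁻ {false} _ ()

≮ᵇ⇒≥ : ∀ m n → T (not (m <ᵇ n)) → n ≤ m
≮ᵇ⇒≥ m n h = ≮⇒≥ (T-not⁻ h ∘ <⇒<ᵇ)

≥⇒≮ᵇ : ∀ {m n} → n ≤ m → T (not (m <ᵇ n))
≥⇒≮ᵇ {m} {n} n≤m = T-not⁺ (λ m<n → <⇒≱ (<ᵇ⇒< m n m<n) n≤m)

AllPairs-resp-⊆ : ∀ {A : Set} {R : A → A → Set} {σ w} → σ ⊆ w → AllPairs R w → AllPairs R σ
AllPairs-resp-⊆ [] [] = []
AllPairs-resp-⊆ (_ ∷ʳ τ) (_ ∷ rs) = AllPairs-resp-⊆ τ rs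
AllPairs-resp-⊆ (refl ∷ τ) (r ∷ rs) = All-resp-⊆ τ r ∷ AllPairs-resp-⊆ τ rs

AllPairs-mapᴬ : ∀ {A : Set} {P : A → Set} {R S : A → A → Set} {xs} →
                (∀ {x y} → P x → P y → R x y → S x y) → All P xs → AllPairs R xs → AllPairs S xs
AllPairs-mapᴬ f [] [] = []
AllPairs-mapᴬ f (px ∷ pxs) (r ∷ rs) =
  All.zipWith (λ (py , rxy) → f px py rxy) (pxs , r) ∷ AllPairs-mapᴬ f pxs rs

Unique⇒length≤ : ∀ {A : Set} {xs ys : List A} → Unique xs → (∀ {z} → z ∈ xs → z ∈ ys) →
                 length xs ≤ length ys
Unique⇒length≤ {xs = []} _ _ = z≤n
Unique⇒length≤ {xs = x ∷ xs} (x∉xs ∷ u) xs⊆ys with ys₁ , ys₂ , refl ← ∈-∃++ (xs⊆ys (here refl)) =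
  subst (suc (length xs) ≤_) (sym (↭-length (shift x ys₁ ys₂)))
    (s≤s (Unique⇒length≤ u λ z∈xs →
      drop-x (∈-resp-↭ (shift x ys₁ ys₂) (xs⊆ys (there z∈xs))) (All.lookup x∉xs z∈xs)))
  where
  drop-x : ∀ {z zs} → z ∈ x ∷ zs → x ≢ z → z ∈ zs
  drop-x (here refl) x≢z = ⊥-elim (x≢z refl)
  drop-x (there z∈zs) _ = z∈zs

Unique-same-members⇒length≡ : ∀ {A : Set} {xs ys : List A} → Unique xs → Unique ys →
                              (∀ {z} → z ∈ xs ⇔ z ∈ ys) → length xs ≡ length ys
Unique-same-members⇒length≡ u u′ same = ↭-length (∼bag⇒↭ (unique∧set⇒bag u u′ same))

length-filterᵇ-map : ∀ {A B : Set} (p : B → Bool) (f : A → B) xs →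
                     length (filterᵇ p (map f xs)) ≡ length (filterᵇ (p ∘ f) xs)
length-filterᵇ-map p f [] = refl
length-filterᵇ-map p f (x ∷ xs) with p (f x)
... | true = cong suc (length-filterᵇ-map p f xs)
... | false = length-filterᵇ-map p f xs

filterᵇ-congᴬ : ∀ {A : Set} {p q : A → Bool} {xs} → All (λ x → p x ≡ q x) xs → filterᵇ p xs ≡ filterᵇ q xs
filterᵇ-congᴬ [] = refl
filterᵇ-congᴬ {p = p} {q} {x ∷ xs} (_ ∷ eqs) with p x | q x
... | true | true = cong (x ∷_) (filterᵇ-congᴬ eqs)
... | false | false = filterᵇ-congᴬ eqs

m≤n⇒∃[o]n≡o+m : ∀ {m n} → m ≤ n → ∃ λ o → n ≡ o + m
m≤n⇒∃[o]n≡o+m {m} {n} m≤n = n ∸ m , sym (m∸n+n≡m m≤n)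

m≤o∧n≤p∧m+n≡o+p⇒m≡o : ∀ {m n o p} → m ≤ o → n ≤ p → m + n ≡ o + p → m ≡ o
m≤o∧n≤p∧m+n≡o+p⇒m≡o {m} {n} {o} {p} m≤o n≤p eq =
  ≤-antisym m≤o (+-cancelʳ-≤ p o m (≤-trans (≤-reflexive (sym eq)) (+-monoʳ-≤ m n≤p)))

∈-subseqs⁺ : ∀ {A : Set} {σ xs : List A} → σ ⊆ xs → σ ∈ subseqs xs
∈-subseqs⁺ [] = here refl
∈-subseqs⁺ {xs = y ∷ ys} (.y ∷ʳ τ) = ∈-++⁺ʳ (map (y ∷_) (subseqs ys)) (∈-subseqs⁺ τ)
∈-subseqs⁺ (refl ∷ τ) = ∈-++⁺ˡ (∈-map⁺ _ (∈-subseqs⁺ τ))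

∈-subseqs⁻ : ∀ {A : Set} (xs : List A) {σ} → σ ∈ subseqs xs → σ ⊆ xs
∈-subseqs⁻ [] (here refl) = []
∈-subseqs⁻ (y ∷ ys) σ∈ with ∈-++⁻ (map (y ∷_) (subseqs ys)) σ∈
... | inj₂ σ∈ys = y ∷ʳ ∈-subseqs⁻ ys σ∈ys
... | inj₁ σ∈y∷ with _ , σ′∈ , refl ← ∈-map⁻ (y ∷_) σ∈y∷ = refl ∷ ∈-subseqs⁻ ys σ′∈

Avoids : List ℕ → List ℕ → Set
Avoids p w = ∀ {σ} → σ ⊆ w → ¬ T (orderIso p σ)

avoids⁺ : ∀ {p w} → Avoids p w → T (not (contains w p))
avoids⁺ {p} {w} av = T-not⁺ λ occ →
  let σ , σ∈ , iso = find (any⁻ (orderIso p) (subseqs w) occ) in av (∈-subseqs⁻ w σ∈) iso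

avoids⁻ : ∀ {p w} → T (not (contains w p)) → Avoids p w
avoids⁻ {p} h τ iso = T-not⁻ h (any⁺ (orderIso p) (lose (∈-subseqs⁺ τ) iso))

Avoids-⊆ : ∀ {p v w} → v ⊆ w → Avoids p w → Avoids p v
Avoids-⊆ v⊆w av τ = av (⊆-trans τ v⊆w)

SameOrder : List ℕ → List ℕ → Set
SameOrder [] [] = ⊤
SameOrder (x ∷ p) (y ∷ σ) = All (λ (x′ , y′) → T ((x <ᵇ x′) ⇔ᵇ (y <ᵇ y′))) (zip p σ) × SameOrder p σ
SameOrder _ _ = ⊥

orderIso⇒SameOrder : ∀ p σ → T (orderIso p σ) → SameOrder p σ
orderIso⇒SameOrder [] [] _ = _
orderIso⇒SameOrder (x ∷ p) (y ∷ σ) h =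
  let h₁ , h₂ = to T-∧ h in all⁺ _ (zip p σ) h₁ , orderIso⇒SameOrder p σ h₂

SameOrder⇒orderIso : ∀ p σ → SameOrder p σ → T (orderIso p σ)
SameOrder⇒orderIso [] [] _ = _
SameOrder⇒orderIso (x ∷ p) (y ∷ σ) (h₁ , h₂) = from T-∧ (all⁻ _ h₁ , SameOrder⇒orderIso p σ h₂)

orderIso⇒length≡ : ∀ p σ → T (orderIso p σ) → length p ≡ length σ
orderIso⇒length≡ p σ = SameOrder⇒length≡ p σ ∘ orderIso⇒SameOrder p σ
  where
  SameOrder⇒length≡ : ∀ p σ → SameOrder p σ → length p ≡ length σ
  SameOrder⇒length≡ [] [] _ = refl
  SameOrder⇒length≡ (x ∷ p) (y ∷ σ) (_ , h) = cong suc (SameOrder⇒length≡ p σ h)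

p231 p312 p321 p4321 p21543 : List ℕ
p231 = 2 ∷ 3 ∷ 1 ∷ []
p312 = 3 ∷ 1 ∷ 2 ∷ []
p321 = 3 ∷ 2 ∷ 1 ∷ []
p4321 = 4 ∷ 3 ∷ 2 ∷ 1 ∷ []
p21543 = 2 ∷ 1 ∷ 5 ∷ 4 ∷ 3 ∷ []

orderIso-231⁻ : ∀ a c d → T (orderIso p231 (a ∷ c ∷ d ∷ [])) → a < c × d ≤ a × d ≤ c
orderIso-231⁻ a c d h with ac ∷ ad ∷ [] , cd ∷ [] , _ ← orderIso⇒SameOrder p231 (a ∷ c ∷ d ∷ []) h =
  <ᵇ⇒< a c ac , ≮ᵇ⇒≥ a d ad , ≮ᵇ⇒≥ c d cd

orderIso-312⁻ : ∀ a c d → T (orderIso p312 (a ∷ c ∷ d ∷ [])) → c ≤ a × d ≤ a × c < d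
orderIso-312⁻ a c d h with ac ∷ ad ∷ [] , cd ∷ [] , _ ← orderIso⇒SameOrder p312 (a ∷ c ∷ d ∷ []) h =
  ≮ᵇ⇒≥ a c ac , ≮ᵇ⇒≥ a d ad , <ᵇ⇒< c d cd

orderIso-321⁻ : ∀ a c d → T (orderIso p321 (a ∷ c ∷ d ∷ [])) → c ≤ a × d ≤ c × d ≤ a
orderIso-321⁻ a c d h with ac ∷ ad ∷ [] , cd ∷ [] , _ ← orderIso⇒SameOrder p321 (a ∷ c ∷ d ∷ []) h =
  ≮ᵇ⇒≥ a c ac , ≮ᵇ⇒≥ c d cd , ≮ᵇ⇒≥ a d ad

orderIso-4321⁻ : ∀ a c d g → T (orderIso p4321 (a ∷ c ∷ d ∷ g ∷ [])) → c ≤ a × d ≤ c × g ≤ d × g ≤ a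
orderIso-4321⁻ a c d g h
  with ac ∷ _ ∷ ag ∷ [] , cd ∷ _ ∷ [] , dg ∷ [] , _ ← orderIso⇒SameOrder p4321 (a ∷ c ∷ d ∷ g ∷ []) h =
  ≮ᵇ⇒≥ a c ac , ≮ᵇ⇒≥ c d cd , ≮ᵇ⇒≥ d g dg , ≮ᵇ⇒≥ a g ag

orderIso-21543⁻ : ∀ a c d g h → T (orderIso p21543 (a ∷ c ∷ d ∷ g ∷ h ∷ [])) →
                  c ≤ a × a < d × g ≤ d × h ≤ g × h ≤ d
orderIso-21543⁻ a c d g h occ
  with ac ∷ ad ∷ _ , _ , dg ∷ dh ∷ [] , gh ∷ [] , _
         ← orderIso⇒SameOrder p21543 (a ∷ c ∷ d ∷ g ∷ h ∷ []) occ =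
  ≮ᵇ⇒≥ a c ac , <ᵇ⇒< a d ad , ≮ᵇ⇒≥ d g dg , ≮ᵇ⇒≥ g h gh , ≮ᵇ⇒≥ d h dh

orderIso-231⁺ : ∀ {a c d} → a < c → d < a → T (orderIso p231 (a ∷ c ∷ d ∷ []))
orderIso-231⁺ {a} {c} {d} a<c d<a = SameOrder⇒orderIso p231 (a ∷ c ∷ d ∷ [])
  (<⇒<ᵇ a<c ∷ ≥⇒≮ᵇ (<⇒≤ d<a) ∷ [] , ≥⇒≮ᵇ (<⇒≤ (<-trans d<a a<c)) ∷ [] , [] , _)

orderIso-312⁺ : ∀ {a c d} → c < d → d < a → T (orderIso p312 (a ∷ c ∷ d ∷ []))
orderIso-312⁺ {a} {c} {d} c<d d<a = SameOrder⇒orderIso p312 (a ∷ c ∷ d ∷ [])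
  (≥⇒≮ᵇ (<⇒≤ (<-trans c<d d<a)) ∷ ≥⇒≮ᵇ (<⇒≤ d<a) ∷ [] , <⇒<ᵇ c<d ∷ [] , [] , _)

orderIso-321⁺ : ∀ {a c d} → c < a → d < c → T (orderIso p321 (a ∷ c ∷ d ∷ []))
orderIso-321⁺ {a} {c} {d} c<a d<c = SameOrder⇒orderIso p321 (a ∷ c ∷ d ∷ [])
  (≥⇒≮ᵇ (<⇒≤ c<a) ∷ ≥⇒≮ᵇ (<⇒≤ (<-trans d<c c<a)) ∷ [] , ≥⇒≮ᵇ (<⇒≤ d<c) ∷ [] , [] , _)

orderIso-4321⁺ : ∀ {a c d g} → c < a → d < c → g < d → T (orderIso p4321 (a ∷ c ∷ d ∷ g ∷ []))
orderIso-4321⁺ {a} {c} {d} {g} c<a d<c g<d = SameOrder⇒orderIso p4321 (a ∷ c ∷ d ∷ g ∷ [])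
  ( ≥⇒≮ᵇ (<⇒≤ c<a) ∷ ≥⇒≮ᵇ (<⇒≤ d<a) ∷ ≥⇒≮ᵇ (<⇒≤ (<-trans g<d d<a)) ∷ []
  , ≥⇒≮ᵇ (<⇒≤ d<c) ∷ ≥⇒≮ᵇ (<⇒≤ (<-trans g<d d<c)) ∷ []
  , ≥⇒≮ᵇ (<⇒≤ g<d) ∷ [] , [] , _)
  where
  d<a : d < a
  d<a = <-trans d<c c<a

orderIso-21543⁺ : ∀ {a c d g h} → c < a → a < h → h ≤ g → g ≤ d →
                  T (orderIso p21543 (a ∷ c ∷ d ∷ g ∷ h ∷ []))
orderIso-21543⁺ {a} {c} {d} {g} {h} c<a a<h h≤g g≤d = SameOrder⇒orderIso p21543 (a ∷ c ∷ d ∷ g ∷ h ∷ [])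
  ( ≥⇒≮ᵇ (<⇒≤ c<a) ∷ <⇒<ᵇ a<d ∷ <⇒<ᵇ a<g ∷ <⇒<ᵇ a<h ∷ []
  , <⇒<ᵇ (<-trans c<a a<d) ∷ <⇒<ᵇ (<-trans c<a a<g) ∷ <⇒<ᵇ (<-trans c<a a<h) ∷ []
  , ≥⇒≮ᵇ g≤d ∷ ≥⇒≮ᵇ (≤-trans h≤g g≤d) ∷ []
  , ≥⇒≮ᵇ h≤g ∷ [] , [] , _)
  where
  a<g : a < g
  a<g = <-≤-trans a<h h≤g
  a<d : a < d
  a<d = <-≤-trans a<g g≤d

-- Layered words

-- cap₃: all layers so far are singletons, so a layer of size 3 is still allowed; cap₂: from now on
-- every layer has size ≤ 2.
data Cap : Set where
  cap₃ cap₂ : Cap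

run : ℕ → ℕ → List ℕ
run b zero = []
run b (suc s) = s + b ∷ run b s

length-run : ∀ b s → length (run b s) ≡ s
length-run b zero = refl
length-run b (suc s) = cong suc (length-run b s)

run-bounds : ∀ b s → All (λ y → b ≤ y × y < s + b) (run b s)
run-bounds b zero = []
run-bounds b (suc s) = (m≤n+m b s , ≤-refl) ∷ All.map (λ (b≤y , y<) → b≤y , m<n⇒m<1+n y<) (run-bounds b s)

data Step : Cap → ℕ → Cap → Set where
  one   : ∀ {c} → Step c 1 c
  two   : ∀ {c} → Step c 2 cap₂
  three : Step cap₃ 3 cap₂

Step-≤3 : ∀ {c s c′} → Step c s c′ → s ≤ 3
Step-≤3 one = s≤s z≤n
Step-≤3 two = s≤s (s≤s z≤n)
Step-≤3 three = ≤-refl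

Step-cap₂-≤2 : ∀ {c s c′} → Step c s c′ → c ≡ cap₂ → s ≤ 2
Step-cap₂-≤2 one _ = s≤s z≤n
Step-cap₂-≤2 two _ = ≤-refl

Step-cap₂-stays : ∀ {c s c′} → Step c s c′ → c ≡ cap₂ → c′ ≡ cap₂
Step-cap₂-stays one c≡cap₂ = c≡cap₂
Step-cap₂-stays two _ = refl

Step-2≤-cap₂ : ∀ {c s c′} → Step c s c′ → 2 ≤ s → c′ ≡ cap₂
Step-2≤-cap₂ one (s≤s ())
Step-2≤-cap₂ two _ = refl
Step-2≤-cap₂ three _ = refl

-- Layered c b m w: w is a layered word on the values b, …, m + b − 1 whose layers are allowed by c.
data Layered : Cap → ℕ → ℕ → List ℕ → Set where
  []    : ∀ {c b} → Layered c b 0 []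
  layer : ∀ {c c′ s b m w} → Step c s c′ → Layered c′ (s + b) m w → Layered c b (s + m) (run b s ++ w)

InRange : ℕ → ℕ → ℕ → Set
InRange b m y = b ≤ y × y < m + b

Layered⇒length : ∀ {c b m w} → Layered c b m w → length w ≡ m
Layered⇒length [] = refl
Layered⇒length (layer {s = s} {b} _ ℓ) =
  trans (length-++ (run b s)) (cong₂ _+_ (length-run b s) (Layered⇒length ℓ))

Layered⇒bounded : ∀ {c b m w} → Layered c b m w → All (InRange b m) w
Layered⇒bounded [] = []
Layered⇒bounded (layer {s = s} {b} {m} _ ℓ) =
  All.++⁺ (All.map (λ (b≤y , y<) → b≤y , <-≤-trans y< (+-monoˡ-≤ b (m≤m+n s m))) (run-bounds b s))
          (All.map (λ {y} (s+b≤y , y<) → ≤-trans (m≤n+m b s) s+b≤y , subst (y <_) (+-reorder m s b) y<)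
                   (Layered⇒bounded ℓ))
  where
  +-reorder : ∀ m s b → m + (s + b) ≡ s + m + b
  +-reorder m s b = trans (sym (+-assoc m s b)) (cong (_+ b) (+-comm m s))

Unique-bounded⇒length≤ : ∀ {b m xs} → Unique xs → All (InRange b m) xs → length xs ≤ m
Unique-bounded⇒length≤ {b} {m} {xs} u bounds =
  subst (length xs ≤_) (length-applyUpTo (_+ b) m) (Unique⇒length≤ u λ y∈ → ∈-range (All.lookup bounds y∈))
  where
  ∈-range : ∀ {y} → InRange b m y → y ∈ applyUpTo (_+ b) m
  ∈-range {y} (b≤y , y<) = subst (_∈ applyUpTo (_+ b) m) (m∸n+n≡m b≤y)
    (∈-applyUpTo⁺ (_+ b) (+-cancelʳ-< b (y ∸ b) m (subst (_< m + b) (sym (m∸n+n≡m b≤y)) y<)))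

-- layered₂₊ c b m: the words of length 1 + m whose first layer has size ≥ 2;
-- layered₃ c b m: the words of length 2 + m whose first layer has size 3.
layered layered₂₊ layered₃ : Cap → ℕ → ℕ → List (List ℕ)
layered c b zero = [] ∷ []
layered c b (suc m) = map (run b 1 ++_) (layered c (suc b) m) ++ layered₂₊ c b m
layered₂₊ c b zero = []
layered₂₊ c b (suc m) = map (run b 2 ++_) (layered cap₂ (2 + b) m) ++ layered₃ c b m
layered₃ cap₂ b m = []
layered₃ cap₃ b zero = []
layered₃ cap₃ b (suc m) = map (run b 3 ++_) (layered cap₂ (3 + b) m)

∈-layered⁺ : ∀ {c b m w} → Layered c b m w → w ∈ layered c b m
∈-layered⁺ [] = here refl
∈-layered⁺ (layer {b = b} one ℓ) = ∈-++⁺ˡ (∈-map⁺ (run b 1 ++_) (∈-layered⁺ ℓ))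
∈-layered⁺ (layer {c} {b = b} {m = m} two ℓ) =
  ∈-++⁺ʳ (map (run b 1 ++_) (layered c (suc b) (suc m))) (∈-++⁺ˡ (∈-map⁺ (run b 2 ++_) (∈-layered⁺ ℓ)))
∈-layered⁺ (layer {b = b} {m = m} three ℓ) =
  ∈-++⁺ʳ (map (run b 1 ++_) (layered cap₃ (suc b) (2 + m)))
    (∈-++⁺ʳ (map (run b 2 ++_) (layered cap₂ (2 + b) (suc m))) (∈-map⁺ (run b 3 ++_) (∈-layered⁺ ℓ)))

∈-layered⁻ : ∀ c b m {w} → w ∈ layered c b m → Layered c b m w
∈-layered₂₊⁻ : ∀ c b m {w} → w ∈ layered₂₊ c b m → Layered c b (suc m) w
∈-layered₃⁻ : ∀ c b m {w} → w ∈ layered₃ c b m → Layered c b (2 + m) w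
∈-layered⁻ c b zero (here refl) = []
∈-layered⁻ c b (suc m) w∈ with ∈-++⁻ (map (run b 1 ++_) (layered c (suc b) m)) w∈
... | inj₁ w∈₁ with _ , v∈ , refl ← ∈-map⁻ _ w∈₁ = layer one (∈-layered⁻ c (suc b) m v∈)
... | inj₂ w∈₂ = ∈-layered₂₊⁻ c b m w∈₂
∈-layered₂₊⁻ c b (suc m) w∈ with ∈-++⁻ (map (run b 2 ++_) (layered cap₂ (2 + b) m)) w∈
... | inj₁ w∈₁ with _ , v∈ , refl ← ∈-map⁻ _ w∈₁ = layer two (∈-layered⁻ cap₂ (2 + b) m v∈)
... | inj₂ w∈₂ = ∈-layered₃⁻ c b m w∈₂
∈-layered₃⁻ cap₃ b (suc m) w∈ with _ , v∈ , refl ← ∈-map⁻ _ w∈ = layer three (∈-layered⁻ cap₂ (3 + b) m v∈)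

head-∈-map-run : ∀ b s {X v} → v ∈ map (run b (suc s) ++_) X → head v ≡ just (s + b)
head-∈-map-run b s v∈ with _ , _ , refl ← ∈-map⁻ (run b (suc s) ++_) v∈ = refl

head-∈-layered₃ : ∀ c b m {v} → v ∈ layered₃ c b m → head v ≡ just (2 + b)
head-∈-layered₃ cap₃ b (suc m) = head-∈-map-run b 2

head-∈-layered₂₊ : ∀ c b m {v} → v ∈ layered₂₊ c b m → ∃ λ s → head v ≡ just (suc s + b)
head-∈-layered₂₊ c b (suc m) v∈ with ∈-++⁻ (map (run b 2 ++_) (layered cap₂ (2 + b) m)) v∈
... | inj₁ v∈₁ = 0 , head-∈-map-run b 1 v∈₁
... | inj₂ v∈₂ = 1 , head-∈-layered₃ c b m v∈₂

map-run-unique : ∀ {b s X} → Unique X → Unique (map (run b s ++_) X)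
map-run-unique {b} {s} = Unique.map⁺ (++-cancelˡ (run b s) _ _)

layered-unique : ∀ c b m → Unique (layered c b m)
layered₂₊-unique : ∀ c b m → Unique (layered₂₊ c b m)
layered₃-unique : ∀ c b m → Unique (layered₃ c b m)
layered-unique c b zero = [] ∷ []
layered-unique c b (suc m) = Unique.++⁺ (map-run-unique (layered-unique c (suc b) m)) (layered₂₊-unique c b m)
  λ (v∈₁ , v∈₂) → let _ , hd = head-∈-layered₂₊ c b m v∈₂ in
    m≢1+n+m b (just-injective (trans (sym (head-∈-map-run b 0 v∈₁)) hd))
layered₂₊-unique c b zero = []
layered₂₊-unique c b (suc m) =
  Unique.++⁺ (map-run-unique (layered-unique cap₂ (2 + b) m)) (layered₃-unique c b m)
  λ (v∈₁ , v∈₂) → 1+n≢n (just-injective (trans (sym (head-∈-layered₃ c b m v∈₂)) (head-∈-map-run b 1 v∈₁)))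
layered₃-unique cap₂ b m = []
layered₃-unique cap₃ b zero = []
layered₃-unique cap₃ b (suc m) = map-run-unique (layered-unique cap₂ (3 + b) m)

layered-above : ∀ c b m → All (All (b ≤_)) (layered c b m)
layered-above c b m = All.tabulate λ w∈ → All.map proj₁ (Layered⇒bounded (∈-layered⁻ c b m w∈))

-- Layered words avoid the patterns

-- A certificate for w assigns to each entry y the least entry lo y of its layer. Entry bounds the layers
-- by 3 entries (2 under cap₂). Precedes relates an entry x to a later entry y: either y lies below x in
-- the layer of x, or y lies in a later layer, and that layer has at most 2 entries if the layer of x has
-- at least 2 (ℓx < x).
Entry : Cap → ℕ → ℕ → ℕ → Set
Entry c b ℓ y = b ≤ ℓ × ℓ ≤ y × y ≤ 2 + ℓ × (c ≡ cap₂ → y ≤ 1 + ℓ)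

Precedes : ℕ → ℕ → ℕ → ℕ → Set
Precedes ℓx x ℓy y = (y < x × ℓx ≤ y × ℓy ≡ ℓx) ⊎ (x < ℓy × (ℓx < x → y ≤ 1 + ℓy))

record Certificate (c : Cap) (b : ℕ) (w : List ℕ) : Set where
  field
    lo      : ℕ → ℕ
    entries : All (λ y → Entry c b (lo y) y) w
    ordered : AllPairs (λ x y → Precedes (lo x) x (lo y) y) w

Precedes-descent : ∀ {ℓx x ℓy y} → Precedes ℓx x ℓy y → y ≤ x → ℓy ≤ y → y < x × ℓx ≤ y × ℓy ≡ ℓx
Precedes-descent (inj₁ p) _ _ = p
Precedes-descent (inj₂ (x<ℓy , _)) y≤x ℓy≤y = ⊥-elim (<⇒≱ x<ℓy (≤-trans ℓy≤y y≤x))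

Precedes-ascent : ∀ {ℓx x ℓy y} → Precedes ℓx x ℓy y → x < y → x < ℓy × (ℓx < x → y ≤ 1 + ℓy)
Precedes-ascent (inj₁ (y<x , _)) x<y = ⊥-elim (<-asym x<y y<x)
Precedes-ascent (inj₂ p) _ = p

Precedes⇒≢ : ∀ {ℓx x ℓy y} → ℓy ≤ y → Precedes ℓx x ℓy y → x ≢ y
Precedes⇒≢ _ (inj₁ (y<x , _)) = >⇒≢ y<x
Precedes⇒≢ ℓy≤y (inj₂ (x<ℓy , _)) = <⇒≢ (<-≤-trans x<ℓy ℓy≤y)

Precedes-cong : ∀ {ℓx ℓx′ x ℓy ℓy′ y} → ℓx ≡ ℓx′ → ℓy ≡ ℓy′ → Precedes ℓx x ℓy y → Precedes ℓx′ x ℓy′ y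
Precedes-cong refl refl p = p

run-precedes : ∀ b s → AllPairs (λ x y → Precedes b x b y) (run b s)
run-precedes b zero = []
run-precedes b (suc s) = All.map (λ (b≤y , y<) → inj₁ (y< , b≤y , refl)) (run-bounds b s) ∷ run-precedes b s

extend : ∀ {c c′ s b w} → Step c s c′ → Certificate c′ (s + b) w → Certificate c b (run b s ++ w)
extend {c} {c′} {s} {b} {w} st cert = record
  { lo      = lo′
  ; entries = All.++⁺ (All.map run-entry (run-bounds b s)) (All.map w-entry entries)
  ; ordered = AllPairs.++⁺ run-ordered w-ordered
                           (All.map (λ x∈run → All.map (cross x∈run) entries) (run-bounds b s))
  }
  where
  open Certificate cert

  lo′ : ℕ → ℕ
  lo′ y = if y <ᵇ s + b then b else lo y

  lo′-run : ∀ {y} → y < s + b → lo′ y ≡ b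
  lo′-run {y} y< with y <ᵇ s + b | <⇒<ᵇ y<
  ... | true | _ = refl

  lo′-w : ∀ {y} → Entry c′ (s + b) (lo y) y → lo′ y ≡ lo y
  lo′-w {y} (s+b≤ℓ , ℓ≤y , _) with y <ᵇ s + b | ≥⇒≮ᵇ {y} (≤-trans s+b≤ℓ ℓ≤y)
  ... | false | _ = refl

  run-entry : ∀ {y} → b ≤ y × y < s + b → Entry c b (lo′ y) y
  run-entry (b≤y , y<) rewrite lo′-run y< =
    ≤-refl , b≤y , ≤-pred (≤-trans y< (+-monoˡ-≤ b (Step-≤3 st))) ,
    λ c≡cap₂ → ≤-pred (≤-trans y< (+-monoˡ-≤ b (Step-cap₂-≤2 st c≡cap₂)))

  w-entry : ∀ {y} → Entry c′ (s + b) (lo y) y → Entry c b (lo′ y) y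
  w-entry e@(s+b≤ℓ , ℓ≤y , y≤2+ℓ , cap₂-bound) rewrite lo′-w e =
    ≤-trans (m≤n+m b s) s+b≤ℓ , ℓ≤y , y≤2+ℓ , cap₂-bound ∘ Step-cap₂-stays st

  run-ordered : AllPairs (λ x y → Precedes (lo′ x) x (lo′ y) y) (run b s)
  run-ordered = AllPairs-mapᴬ (λ ex ey → Precedes-cong (sym ex) (sym ey))
                              (All.map (lo′-run ∘ proj₂) (run-bounds b s)) (run-precedes b s)

  w-ordered : AllPairs (λ x y → Precedes (lo′ x) x (lo′ y) y) w
  w-ordered = AllPairs-mapᴬ (λ ex ey → Precedes-cong (sym ex) (sym ey)) (All.map lo′-w entries) ordered

  cross : ∀ {x y} → b ≤ x × x < s + b → Entry c′ (s + b) (lo y) y → Precedes (lo′ x) x (lo′ y) y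
  cross {x} (_ , x<) e@(s+b≤ℓ , _ , _ , cap₂-bound) rewrite lo′-run x< | lo′-w e =
    inj₂ (<-≤-trans x< s+b≤ℓ , λ b<x → cap₂-bound (Step-2≤-cap₂ st (+-cancelʳ-≤ b 2 s (≤-trans (s≤s b<x) x<))))

certificate : ∀ {c b m w} → Layered c b m w → Certificate c b w
certificate [] = record { lo = λ _ → 0 ; entries = [] ; ordered = [] }
certificate (layer st ℓ) = extend st (certificate ℓ)

forbidden : Cap → List (List ℕ)
forbidden cap₃ = A₁
forbidden cap₂ = p321 ∷ A₁

Admissible : Cap → List ℕ → Set
Admissible c w = All (λ p → Avoids p w) (forbidden c)

Admissible-⊆ : ∀ {c v w} → v ⊆ w → Admissible c w → Admissible c v
Admissible-⊆ v⊆w = All.map (λ {p} → Avoids-⊆ {p} v⊆w)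

Admissible⇒A₁ : ∀ {c w} → Admissible c w → All (λ p → Avoids p w) A₁
Admissible⇒A₁ {cap₃} adm = adm
Admissible⇒A₁ {cap₂} (_ ∷ adm) = adm

module _ {cap b w} (cert : Certificate cap b w) where
  open Certificate cert

  Certificate⇒Unique : Unique w
  Certificate⇒Unique = AllPairs-mapᴬ (λ _ (_ , ℓy≤y , _) → Precedes⇒≢ ℓy≤y) entries ordered

  avoids-231 : Avoids p231 w
  avoids-231 {σ} τ occ with orderIso⇒length≡ p231 σ occ
  avoids-231 {a ∷ c ∷ d ∷ []} τ occ | refl
    with _ ∷ _ ∷ (_ , ℓd≤d , _) ∷ [] ← All-resp-⊆ τ entries
       | (Pac ∷ _ ∷ []) ∷ (Pcd ∷ []) ∷ [] ∷ [] ← AllPairs-resp-⊆ τ ordered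
       | a<c , d≤a , d≤c ← orderIso-231⁻ a c d occ
    with a<ℓc , _ ← Precedes-ascent Pac a<c
       | _ , ℓc≤d , _ ← Precedes-descent Pcd d≤c ℓd≤d
    = <⇒≱ (<-≤-trans a<ℓc ℓc≤d) d≤a

  avoids-312 : Avoids p312 w
  avoids-312 {σ} τ occ with orderIso⇒length≡ p312 σ occ
  avoids-312 {a ∷ c ∷ d ∷ []} τ occ | refl
    with _ ∷ (_ , ℓc≤c , _) ∷ (_ , ℓd≤d , _) ∷ [] ← All-resp-⊆ τ entries
       | (Pac ∷ Pad ∷ []) ∷ (Pcd ∷ []) ∷ [] ∷ [] ← AllPairs-resp-⊆ τ ordered
       | c≤a , d≤a , c<d ← orderIso-312⁻ a c d occ
    with _ , ℓa≤c , _ ← Precedes-descent Pac c≤a ℓc≤c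
       | _ , _ , ℓd≡ℓa ← Precedes-descent Pad d≤a ℓd≤d
       | c<ℓd , _ ← Precedes-ascent Pcd c<d
    = <-irrefl refl (<-≤-trans c<ℓd (≤-trans (≤-reflexive ℓd≡ℓa) ℓa≤c))

  avoids-321 : cap ≡ cap₂ → Avoids p321 w
  avoids-321 cap≡cap₂ {σ} τ occ with orderIso⇒length≡ p321 σ occ
  avoids-321 cap≡cap₂ {a ∷ c ∷ d ∷ []} τ occ | refl
    with (_ , _ , _ , a≤1+ℓa) ∷ (_ , ℓc≤c , _) ∷ (_ , ℓd≤d , _) ∷ [] ← All-resp-⊆ τ entries
       | (Pac ∷ Pad ∷ []) ∷ (Pcd ∷ []) ∷ [] ∷ [] ← AllPairs-resp-⊆ τ ordered
       | c≤a , d≤c , d≤a ← orderIso-321⁻ a c d occ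
    with c<a , _ ← Precedes-descent Pac c≤a ℓc≤c
       | d<c , _ ← Precedes-descent Pcd d≤c ℓd≤d
       | _ , ℓa≤d , _ ← Precedes-descent Pad d≤a ℓd≤d
    = <⇒≱ (≤-trans (s≤s (s≤s ℓa≤d)) (≤-trans (s≤s d<c) c<a)) (a≤1+ℓa cap≡cap₂)

  avoids-4321 : Avoids p4321 w
  avoids-4321 {σ} τ occ with orderIso⇒length≡ p4321 σ occ
  avoids-4321 {a ∷ c ∷ d ∷ g ∷ []} τ occ | refl
    with (_ , _ , a≤2+ℓa , _) ∷ (_ , ℓc≤c , _) ∷ (_ , ℓd≤d , _) ∷ (_ , ℓg≤g , _) ∷ [] ← All-resp-⊆ τ entries
       | (Pac ∷ _ ∷ Pag ∷ []) ∷ (Pcd ∷ _ ∷ []) ∷ (Pdg ∷ []) ∷ [] ∷ [] ← AllPairs-resp-⊆ τ ordered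
       | c≤a , d≤c , g≤d , g≤a ← orderIso-4321⁻ a c d g occ
    with c<a , _ ← Precedes-descent Pac c≤a ℓc≤c
       | d<c , _ ← Precedes-descent Pcd d≤c ℓd≤d
       | g<d , _ ← Precedes-descent Pdg g≤d ℓg≤g
       | _ , ℓa≤g , _ ← Precedes-descent Pag g≤a ℓg≤g
    = <⇒≱ (≤-trans (s≤s (s≤s (s≤s ℓa≤g))) (≤-trans (s≤s (s≤s g<d)) (≤-trans (s≤s d<c) c<a))) a≤2+ℓa

  avoids-21543 : Avoids p21543 w
  avoids-21543 {σ} τ occ with orderIso⇒length≡ p21543 σ occ
  avoids-21543 {a ∷ c ∷ d ∷ g ∷ h ∷ []} τ occ | refl
    with _ ∷ (_ , ℓc≤c , _) ∷ _ ∷ (_ , ℓg≤g , _) ∷ (_ , ℓh≤h , _) ∷ [] ← All-resp-⊆ τ entries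
       | (Pac ∷ Pad ∷ _) ∷ _ ∷ (Pdg ∷ Pdh ∷ []) ∷ (Pgh ∷ []) ∷ [] ∷ [] ← AllPairs-resp-⊆ τ ordered
       | c≤a , a<d , g≤d , h≤g , h≤d ← orderIso-21543⁻ a c d g h occ
    with c<a , ℓa≤c , _ ← Precedes-descent Pac c≤a ℓc≤c
       | _ , d≤1+ℓd ← Precedes-ascent Pad a<d
       | g<d , _ ← Precedes-descent Pdg g≤d ℓg≤g
       | h<g , _ ← Precedes-descent Pgh h≤g ℓh≤h
       | _ , ℓd≤h , _ ← Precedes-descent Pdh h≤d ℓh≤h
    = <⇒≱ (≤-trans (s≤s (s≤s ℓd≤h)) (≤-trans (s≤s h<g) g<d)) (d≤1+ℓd (≤-<-trans ℓa≤c c<a))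

Certificate⇒Admissible : ∀ {c b w} → Certificate c b w → Admissible c w
Certificate⇒Admissible {cap₃} cert =
  avoids-231 cert ∷ avoids-312 cert ∷ avoids-4321 cert ∷ avoids-21543 cert ∷ []
Certificate⇒Admissible {cap₂} cert =
  avoids-321 cert refl ∷ avoids-231 cert ∷ avoids-312 cert ∷ avoids-4321 cert ∷ avoids-21543 cert ∷ []

-- Avoiders are layered

split-below : ∀ x xs → ∃₂ λ D R → xs ≡ D ++ R × All (_< x) D × Maybe.All (x ≤_) (head R)
split-below x xs =
  takeWhile (_<? x) xs , dropWhile (_<? x) xs , sym (takeWhile++dropWhile (_<? x) xs) ,
  all-takeWhile (_<? x) xs , Maybe.map ≮⇒≥ (all-head-dropWhile (_<? x) xs)

231-free⇒above : ∀ {x D R} → Avoids p231 (x ∷ D ++ R) → Maybe.All (x ≤_) (head R) → All (x ≢_) R → All (x <_) R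
231-free⇒above {R = []} _ _ _ = []
231-free⇒above {x} {D} {y ∷ R} av (just x≤y) (x≢y ∷ x∉R) = x<y ∷ All.tabulate x<r
  where
  x<y : x < y
  x<y = ≤∧≢⇒< x≤y x≢y
  x<r : ∀ {r} → r ∈ R → x < r
  x<r {r} r∈R with r <? x
  ... | yes r<x = ⊥-elim (av (refl ∷ ++⁺ˡ D (refl ∷ from∈ r∈R)) (orderIso-231⁺ x<y r<x))
  ... | no r≮x = ≤∧≢⇒< (≮⇒≥ r≮x) (All.lookup x∉R r∈R)

312-free⇒decreasing : ∀ {x D R} → Avoids p312 (x ∷ D ++ R) → All (_< x) D → Unique D → AllPairs _>_ D
312-free⇒decreasing {D = []} _ _ _ = []
312-free⇒decreasing {x} {d ∷ D} {R} av (_ ∷ D<x) (d∉D ∷ uD) =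
  All.tabulate e<d ∷ 312-free⇒decreasing (Avoids-⊆ {p312} (refl ∷ d ∷ʳ ⊆-refl) av) D<x uD
  where
  e<d : ∀ {e} → e ∈ D → e < d
  e<d {e} e∈D with d <? e
  ... | yes d<e = ⊥-elim (av (refl ∷ refl ∷ ++⁺ʳ R (from∈ e∈D)) (orderIso-312⁺ d<e (All.lookup D<x e∈D)))
  ... | no d≮e = ≤∧≢⇒< (≮⇒≥ d≮e) (≢-sym (All.lookup d∉D e∈D))

decreasing⇒run : ∀ {b t D} → AllPairs _>_ D → All (InRange b t) D → length D ≡ t → D ≡ run b t
decreasing⇒run {D = []} [] [] refl = refl
decreasing⇒run {b} {D = d ∷ D} (d>D ∷ dec) ((b≤d , d<) ∷ bounds) refl =
  cong₂ _∷_ d≡length+b (decreasing⇒run dec D-bounds refl)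
  where
  D≤d∸b : length D ≤ d ∸ b
  D≤d∸b = Unique-bounded⇒length≤ (AllPairs.map >⇒≢ dec)
            (All.zipWith (λ (e<d , b≤e , _) → b≤e , subst (_ <_) (sym (m∸n+n≡m b≤d)) e<d) (d>D , bounds))
  d≡length+b : d ≡ length D + b
  d≡length+b = ≤-antisym (≤-pred d<) (subst (length D + b ≤_) (m∸n+n≡m b≤d) (+-monoˡ-≤ b D≤d∸b))
  D-bounds : All (InRange b (length D)) D
  D-bounds = All.zipWith (λ (e<d , b≤e , _) → b≤e , subst (_ <_) d≡length+b e<d) (d>D , bounds)

-- The entries after x that are smaller than x form a prefix D (no 231), which decreases (no 312);
-- counting entries shows that D holds all of x − 1, …, b.
first-layer : ∀ {b m x xs} → length xs ≡ m → Unique (x ∷ xs) → All (InRange b (suc m)) (x ∷ xs) →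
              Avoids p231 (x ∷ xs) → Avoids p312 (x ∷ xs) →
              ∃₂ λ t R → x ∷ xs ≡ run b (suc t) ++ R × m ≡ t + length R × All (InRange (suc t + b) (length R)) R
first-layer {b} {m} {x} {xs} len (x∉xs ∷ u) ((b≤x , x<) ∷ bounds) a231 a312
  with t , refl ← m≤n⇒∃[o]n≡o+m b≤x
  with D , R , refl , D<x , R-head ← split-below (t + b) xs
  with k , refl ← m≤n⇒∃[o]m+o≡n (≤-pred (+-cancelʳ-< b t (suc m) x<))
  = t , R , cong (λ D → t + b ∷ D ++ R) D≡run , cong (t +_) (sym |R|≡k) ,
    subst (λ k → All (InRange (suc t + b) k) R) (sym |R|≡k) R-bounds
  where
  D-bounds : All (InRange b t) D
  D-bounds = All.zipWith (λ ((b≤y , _) , y<x) → b≤y , y<x) (All.++⁻ˡ D bounds , D<x)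
  R-bounds : All (InRange (suc t + b) k) R
  R-bounds = All.zipWith (λ {y} ((_ , y<) , x<y) → x<y , subst (y <_) (+-reorder t k b) y<)
               (All.++⁻ʳ D bounds , 231-free⇒above a231 R-head (All.++⁻ʳ D x∉xs))
    where
    open +-*-Solver
    +-reorder : ∀ t k b → suc (t + k) + b ≡ k + (suc t + b)
    +-reorder = solve 3 (λ t k b → con 1 :+ t :+ k :+ b := k :+ (con 1 :+ t :+ b)) refl
  |D|≡t : length D ≡ t
  |D|≡t = m≤o∧n≤p∧m+n≡o+p⇒m≡o (Unique-bounded⇒length≤ (AllPairs-resp-⊆ (++⁺ʳ R ⊆-refl) u) D-bounds)
                    (Unique-bounded⇒length≤ (AllPairs-resp-⊆ (++⁺ˡ D ⊆-refl) u) R-bounds)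
                    (trans (sym (length-++ D)) len)
  |R|≡k : length R ≡ k
  |R|≡k = +-cancelˡ-≡ t _ _ (trans (cong (_+ length R) (sym |D|≡t)) (trans (sym (length-++ D)) len))
  D≡run : D ≡ run b t
  D≡run = decreasing⇒run (312-free⇒decreasing a312 D<x (AllPairs-resp-⊆ (++⁺ʳ R ⊆-refl) u)) D-bounds |D|≡t

layer-size : ∀ {c b t R} → Admissible c (run b (suc t) ++ R) → ∃ λ c′ → Step c (suc t) c′
layer-size {t = zero} _ = _ , one
layer-size {t = suc zero} _ = _ , two
layer-size {cap₃} {t = suc (suc zero)} _ = _ , three
layer-size {cap₂} {b} {t = suc (suc zero)} (a321 ∷ _) =
  ⊥-elim (a321 (refl ∷ refl ∷ refl ∷ minimum _) (orderIso-321⁺ (n<1+n (suc b)) (n<1+n b)))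
layer-size {c} {b} {suc (suc (suc t))} adm with _ ∷ _ ∷ a4321 ∷ _ ← Admissible⇒A₁ {c} adm =
  ⊥-elim (a4321 (refl ∷ refl ∷ refl ∷ refl ∷ minimum _)
                (orderIso-4321⁺ (n<1+n (2 + t + b)) (n<1+n (1 + t + b)) (n<1+n (t + b))))

-- 21543 = 21 ⊕ 321
21543-free⇒321-free : ∀ {b u R} → (suc b ∷ b ∷ []) ⊆ u → All (2 + b ≤_) R →
                      Avoids p21543 (u ++ R) → Avoids p321 R
21543-free⇒321-free pair⊆u R-above av {σ} τ occ with orderIso⇒length≡ p321 σ occ
21543-free⇒321-free {b} pair⊆u R-above av {e ∷ f ∷ g ∷ []} τ occ | refl
  with f≤e , g≤f , _ ← orderIso-321⁻ e f g occ
     | _ ∷ _ ∷ 2+b≤g ∷ [] ← All-resp-⊆ τ R-above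
  = av (++⁺ pair⊆u τ) (orderIso-21543⁺ (n<1+n b) 2+b≤g g≤f f≤e)

A₁-free⇒Admissible-cap₂ : ∀ {b u R} → (suc b ∷ b ∷ []) ⊆ u → All (2 + b ≤_) R →
                          All (λ p → Avoids p (u ++ R)) A₁ → Admissible cap₂ R
A₁-free⇒Admissible-cap₂ {u = u} pair⊆u R-above A₁-free@(_ ∷ _ ∷ _ ∷ a21543 ∷ []) =
  21543-free⇒321-free pair⊆u R-above a21543 ∷ All.map (λ {p} → Avoids-⊆ {p} (++⁺ˡ u ⊆-refl)) A₁-free

Admissible-tail : ∀ {c c′ s b R} → Step c s c′ → All (s + b ≤_) R →
                  Admissible c (run b s ++ R) → Admissible c′ R
Admissible-tail {b = b} one _ adm = Admissible-⊆ (++⁺ˡ (run b 1) ⊆-refl) adm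
Admissible-tail {c} two R-above adm = A₁-free⇒Admissible-cap₂ (refl ∷ refl ∷ []) R-above (Admissible⇒A₁ {c} adm)
Admissible-tail three R-above adm =
  A₁-free⇒Admissible-cap₂ (_ ∷ʳ refl ∷ refl ∷ []) (All.map (≤-trans (n≤1+n _)) R-above)
                          (Admissible⇒A₁ {cap₃} adm)

layered-complete : ∀ {c b m w} → Acc _<_ m → length w ≡ m → Unique w → All (InRange b m) w → Admissible c w →
                   Layered c b m w
layered-complete {w = []} _ refl _ _ _ = []
layered-complete {m = zero} {_ ∷ _} _ () _ _ _
layered-complete {c} {b} {suc m} {x ∷ xs} (acc rec) len u bounds adm
  with a231 ∷ a312 ∷ _ ← Admissible⇒A₁ adm
  with t , R , refl , refl , R-bounds ← first-layer (suc-injective len) u bounds a231 a312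
  with c′ , st ← layer-size {c} {b} {t} {R} adm
  = layer st (layered-complete (rec (s≤s (m≤n+m (length R) t))) refl
                               (AllPairs-resp-⊆ (++⁺ˡ (run b (suc t)) ⊆-refl) u)
                               R-bounds (Admissible-tail st (All.map proj₁ R-bounds) adm))

Layered⇔ : ∀ {c b m w} → Layered c b m w ⇔ (length w ≡ m × All (InRange b m) w × Unique w × Admissible c w)
Layered⇔ {m = m} = mk⇔
  (λ ℓ → Layered⇒length ℓ , Layered⇒bounded ℓ ,
         Certificate⇒Unique (certificate ℓ) , Certificate⇒Admissible (certificate ℓ))
  (λ (len , bounds , u , adm) → layered-complete (<-wellFounded m) len u bounds adm)

distinct⇒Unique : ∀ w → T (distinct w) → Unique w
distinct⇒Unique [] _ = []
distinct⇒Unique (x ∷ xs) h =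
  let h₁ , h₂ = to T-∧ h in
  All.map (λ {y} x≢ᵇy → T-not⁻ x≢ᵇy ∘ ≡⇒≡ᵇ x y) (all⁺ (x ≢ᵇ_) xs h₁) ∷ distinct⇒Unique xs h₂

Unique⇒distinct : ∀ {w} → Unique w → T (distinct w)
Unique⇒distinct [] = _
Unique⇒distinct {x ∷ xs} (x∉xs ∷ u) =
  from T-∧ (all⁻ (x ≢ᵇ_) (All.map (λ {y} x≢y → T-not⁺ (x≢y ∘ ≡ᵇ⇒≡ x y)) x∉xs) , Unique⇒distinct u)

avoidsAll⇔ : ∀ {S w} → T (avoidsAll S w) ⇔ All (λ p → Avoids p w) S
avoidsAll⇔ {S} {w} = mk⇔ (All.map (λ {p} → avoids⁻ {p}) ∘ all⁺ (λ p → not (contains w p)) S)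
                         (all⁻ (λ p → not (contains w p)) ∘ All.map (λ {p} → avoids⁺ {p}))

toWord : ∀ {n m} → Vec (Fin n) m → List ℕ
toWord v = map toℕ (toList v)

toWord-injective : ∀ {n m} {v v′ : Vec (Fin n) m} → toWord v ≡ toWord v′ → v ≡ v′
toWord-injective {v = []} {[]} _ = refl
toWord-injective {v = i ∷ v} {j ∷ v′} eq =
  let i≡j , v≡v′ = ∷-injective eq in cong₂ _∷_ (toℕ-injective i≡j) (toWord-injective v≡v′)

toWord-bounded : ∀ {n m} (v : Vec (Fin n) m) → length (toWord v) ≡ m × All (_< n) (toWord v)
toWord-bounded [] = refl , []
toWord-bounded (i ∷ v) = let len , bounds = toWord-bounded v in cong suc len , toℕ<n i ∷ bounds

fromWord : ∀ {n w} → All (_< n) w → Vec (Fin n) (length w)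
fromWord [] = []
fromWord (y<n ∷ bounds) = fromℕ< y<n ∷ fromWord bounds

toWord-fromWord : ∀ {n w} (bounds : All (_< n) w) → toWord (fromWord bounds) ≡ w
toWord-fromWord [] = refl
toWord-fromWord (y<n ∷ bounds) = cong₂ _∷_ (toℕ-fromℕ< y<n) (toWord-fromWord bounds)

∈-allVecs : ∀ {m n} (v : Vec (Fin n) m) → v ∈ allVecs m n
∈-allVecs [] = here refl
∈-allVecs {suc m} {n} (i ∷ v) =
  ∈-concatMap⁺ (λ j → map (j ∷_) (allVecs m n)) (lose (∈-allFin i) (∈-map⁺ (i ∷_) (∈-allVecs v)))

allVecs-unique : ∀ m n → Unique (allVecs m n)
allVecs-unique zero n = [] ∷ []
allVecs-unique (suc m) n =
  subst Unique (sym (concatMap≡cartesianProduct (allFin n)))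
        (Unique.cartesianProductWith⁺ _∷_ Vec.∷-injective (Unique.allFin⁺ n) (allVecs-unique m n))
  where
  concatMap≡cartesianProduct : ∀ is → concatMap (λ i → map (i ∷_) (allVecs m n)) is ≡
                                      cartesianProductWith _∷_ is (allVecs m n)
  concatMap≡cartesianProduct [] = refl
  concatMap≡cartesianProduct (i ∷ is) = cong (map (i ∷_) (allVecs m n) ++_) (concatMap≡cartesianProduct is)

∈-words⇔ : ∀ {n w} → w ∈ map word (allVecs n n) ⇔ (length w ≡ n × All (_< n) w)
∈-words⇔ {n} {w} = mk⇔ to′ from′
  where
  to′ : w ∈ map word (allVecs n n) → length w ≡ n × All (_< n) w
  to′ w∈ with v , _ , refl ← ∈-map⁻ word w∈ = toWord-bounded v
  from′ : length w ≡ n × All (_< n) w → w ∈ map word (allVecs n n)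
  from′ (refl , bounds) =
    subst (_∈ map word (allVecs n n)) (toWord-fromWord bounds) (∈-map⁺ word (∈-allVecs (fromWord bounds)))

-- Counting by inversions

countInv : ℕ → List (List ℕ) → ℕ
countInv k ws = length (filterᵇ (λ w → inv w ≡ᵇ k) ws)

countAvInv≡countInv : ∀ n k → countAvInv A₁ n k ≡ countInv k (layered cap₃ 0 n)
countAvInv≡countInv n k = begin
  length (filterᵇ (Q ∘ word) (allVecs n n)) ≡⟨ length-filterᵇ-map Q word (allVecs n n) ⟨
  length avoiders                            ≡⟨ Unique-same-members⇒length≡ avoiders-unique layered-words-unique same ⟩
  length layered-words                       ∎
  where
  open ≡-Reasoning
  Q : List ℕ → Bool
  Q w = distinct w ∧ avoidsAll A₁ w ∧ (inv w ≡ᵇ k)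
  avoiders layered-words : List (List ℕ)
  avoiders = filterᵇ Q (map word (allVecs n n))
  layered-words = filterᵇ (λ w → inv w ≡ᵇ k) (layered cap₃ 0 n)

  avoiders-unique : Unique avoiders
  avoiders-unique = Unique.filter⁺ (T? ∘ Q) (Unique.map⁺ toWord-injective (allVecs-unique n n))
  layered-words-unique : Unique layered-words
  layered-words-unique = Unique.filter⁺ _ (layered-unique cap₃ 0 n)

  avoider⇒layered : ∀ {w} → w ∈ avoiders → w ∈ layered-words
  avoider⇒layered {w} w∈ =
    let w∈words , q = ∈-filter⁻ (T? ∘ Q) w∈
        len , bounds = to ∈-words⇔ w∈words
        d , ai = to T-∧ q
        a , i = to T-∧ ai
        in-range = All.map (λ {y} y<n → z≤n , subst (y <_) (sym (+-identityʳ n)) y<n) bounds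
    in ∈-filter⁺ _ (∈-layered⁺ (from Layered⇔ (len , in-range , distinct⇒Unique w d , to avoidsAll⇔ a))) i

  layered⇒avoider : ∀ {w} → w ∈ layered-words → w ∈ avoiders
  layered⇒avoider w∈ =
    let w∈layered , i = ∈-filter⁻ _ w∈
        len , in-range , u , adm = to Layered⇔ (∈-layered⁻ cap₃ 0 n w∈layered)
        bounds = All.map (λ {y} (_ , y<) → subst (y <_) (+-identityʳ n) y<) in-range
        q = from T-∧ (Unique⇒distinct u , from T-∧ (from avoidsAll⇔ adm , i))
    in ∈-filter⁺ (T? ∘ Q) (from ∈-words⇔ (len , bounds)) q

  same : ∀ {w} → w ∈ avoiders ⇔ w ∈ layered-words
  same = mk⇔ avoider⇒layered layered⇒avoider

inv-++ : ∀ {u v} → All (λ x → All (x <_) v) u → inv (u ++ v) ≡ inv u + inv v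
inv-++ [] = refl
inv-++ {x ∷ u} {v} (x<v ∷ u<v) = begin
  length (filterᵇ (_<ᵇ x) (u ++ v)) + inv (u ++ v) ≡⟨ cong₂ _+_ (cong length below-x) (inv-++ u<v) ⟩
  length (filterᵇ (_<ᵇ x) u) + (inv u + inv v)     ≡⟨ sym (+-assoc _ (inv u) (inv v)) ⟩
  length (filterᵇ (_<ᵇ x) u) + inv u + inv v       ∎
  where
  open ≡-Reasoning
  none-below-x : filterᵇ (_<ᵇ x) v ≡ []
  none-below-x = filter-none (T? ∘ (_<ᵇ x)) (All.map (λ {y} x<y → <-asym x<y ∘ <ᵇ⇒< y x) x<v)
  below-x : filterᵇ (_<ᵇ x) (u ++ v) ≡ filterᵇ (_<ᵇ x) u
  below-x = begin
    filterᵇ (_<ᵇ x) (u ++ v)               ≡⟨ filter-++ (T? ∘ (_<ᵇ x)) u v ⟩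
    filterᵇ (_<ᵇ x) u ++ filterᵇ (_<ᵇ x) v ≡⟨ cong (filterᵇ (_<ᵇ x) u ++_) none-below-x ⟩
    filterᵇ (_<ᵇ x) u ++ []                ≡⟨ ++-identityʳ _ ⟩
    filterᵇ (_<ᵇ x) u                      ∎

inv-run : ∀ b s → inv (run b (suc s)) ≡ s + inv (run b s)
inv-run b s = cong (_+ inv (run b s)) (trans (cong length all-below) (length-run b s))
  where
  all-below : filterᵇ (_<ᵇ s + b) (run b s) ≡ run b s
  all-below = filter-all (T? ∘ (_<ᵇ s + b)) (All.map (<⇒<ᵇ ∘ proj₂) (run-bounds b s))

inv-run₂ : ∀ b → inv (run b 2) ≡ 1
inv-run₂ b = inv-run b 1

inv-run₃ : ∀ b → inv (run b 3) ≡ 3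
inv-run₃ b = trans (inv-run b 2) (cong (2 +_) (inv-run₂ b))

countInv-++ : ∀ k xs ys → countInv k (xs ++ ys) ≡ countInv k xs + countInv k ys
countInv-++ k xs ys = trans (cong length (filter-++ _ xs ys)) (length-++ (filterᵇ (λ w → inv w ≡ᵇ k) xs))

+-≡ᵇ-cancelˡ : ∀ i m n → (i + m ≡ᵇ i + n) ≡ (m ≡ᵇ n)
+-≡ᵇ-cancelˡ zero m n = refl
+-≡ᵇ-cancelˡ (suc i) m n = +-≡ᵇ-cancelˡ i m n

module _ {b s X} (X-above : All (All (s + b ≤_)) X) where

  inv-run-++ : All (λ w → inv (run b s ++ w) ≡ inv (run b s) + inv w) X
  inv-run-++ = All.map (λ w-above → inv-++ (All.map (λ (_ , y<) → All.map (<-≤-trans y<) w-above) (run-bounds b s)))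
               X-above

  countInv-map-run : ∀ i k → inv (run b s) ≡ i → countInv (i + k) (map (run b s ++_) X) ≡ countInv k X
  countInv-map-run i k refl = begin
    length (filterᵇ p (map (run b s ++_) X)) ≡⟨ length-filterᵇ-map p (run b s ++_) X ⟩
    length (filterᵇ (p ∘ (run b s ++_)) X)   ≡⟨ cong length (filterᵇ-congᴬ (All.map offset inv-run-++)) ⟩
    countInv k X                             ∎
    where
    open ≡-Reasoning
    p : List ℕ → Bool
    p w = inv w ≡ᵇ inv (run b s) + k
    offset : ∀ {w} → inv (run b s ++ w) ≡ inv (run b s) + inv w → p (run b s ++ w) ≡ (inv w ≡ᵇ k)
    offset {w} eq = trans (cong (_≡ᵇ inv (run b s) + k) eq) (+-≡ᵇ-cancelˡ (inv (run b s)) (inv w) k)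

  countInv-map-run-below : ∀ k → k < inv (run b s) → countInv k (map (run b s ++_) X) ≡ 0
  countInv-map-run-below k k< = begin
    length (filterᵇ p (map (run b s ++_) X)) ≡⟨ length-filterᵇ-map p (run b s ++_) X ⟩
    length (filterᵇ (p ∘ (run b s ++_)) X)   ≡⟨ cong length (filter-none (T? ∘ (p ∘ (run b s ++_))) none) ⟩
    0                                        ∎
    where
    open ≡-Reasoning
    p : List ℕ → Bool
    p w = inv w ≡ᵇ k
    too-many : ∀ {w} → inv (run b s ++ w) ≡ inv (run b s) + inv w → ¬ T (p (run b s ++ w))
    too-many {w} eq t = <⇒≱ k< (≤-trans (m≤m+n _ (inv w)) (≤-reflexive (trans (sym eq) (≡ᵇ⇒≡ _ k t))))
    none : All (λ w → ¬ T (p (run b s ++ w))) X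
    none = All.map too-many inv-run-++

countInv-layered : ∀ c b m k →
  countInv k (layered c b (suc m)) ≡ countInv k (layered c (suc b) m) + countInv k (layered₂₊ c b m)
countInv-layered c b m k =
  trans (countInv-++ k (map (run b 1 ++_) (layered c (suc b) m)) (layered₂₊ c b m))
        (cong (_+ countInv k (layered₂₊ c b m)) (countInv-map-run (layered-above c (suc b) m) 0 k refl))

countInv-layered₂₊ : ∀ c b m k → countInv (suc k) (layered₂₊ c b (suc m)) ≡
                                  countInv k (layered cap₂ (2 + b) m) + countInv (suc k) (layered₃ c b m)
countInv-layered₂₊ c b m k =
  trans (countInv-++ (suc k) (map (run b 2 ++_) (layered cap₂ (2 + b) m)) (layered₃ c b m))
        (cong (_+ countInv (suc k) (layered₃ c b m))
              (countInv-map-run (layered-above cap₂ (2 + b) m) 1 k (inv-run₂ b)))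

countInv-layered₃ : ∀ b m k → countInv (3 + k) (layered₃ cap₃ b (suc m)) ≡ countInv k (layered cap₂ (3 + b) m)
countInv-layered₃ b m k = countInv-map-run (layered-above cap₂ (3 + b) m) 3 k (inv-run₃ b)

countInv-layered₂₊-0 : ∀ c b m → countInv 0 (layered₂₊ c b m) ≡ 0
countInv-layered₂₊-0 c b zero = refl
countInv-layered₂₊-0 c b (suc m) =
  trans (countInv-++ 0 (map (run b 2 ++_) (layered cap₂ (2 + b) m)) (layered₃ c b m))
        (cong₂ _+_ (countInv-map-run-below (layered-above cap₂ (2 + b) m) 0 (≤-reflexive (sym (inv-run₂ b))))
                   (layered₃-0 c m))
  where
  layered₃-0 : ∀ c m → countInv 0 (layered₃ c b m) ≡ 0
  layered₃-0 cap₂ m = refl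
  layered₃-0 cap₃ zero = refl
  layered₃-0 cap₃ (suc m) =
    countInv-map-run-below (layered-above cap₂ (3 + b) m) 0 (≤-trans (s≤s z≤n) (≤-reflexive (sym (inv-run₃ b))))

-- Binomial sums

∸-Pascal : ∀ n a k → a ≤ k → (suc n ∸ a) C suc k ≡ (n ∸ a) C k + (n ∸ a) C suc k
∸-Pascal n a k a≤k with a ≤? n
... | yes a≤n = begin
  (suc n ∸ a) C suc k           ≡⟨ cong (_C suc k) (+-∸-assoc 1 a≤n) ⟩
  suc (n ∸ a) C suc k           ≡⟨ sym (nCk+nC[k+1]≡[n+1]C[k+1] (n ∸ a) k) ⟩
  (n ∸ a) C k + (n ∸ a) C suc k ∎
  where open ≡-Reasoning
... | no a≰n = begin
  (suc n ∸ a) C suc k           ≡⟨ cong (_C suc k) (m≤n⇒m∸n≡0 n<a) ⟩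
  0                             ≡⟨ sym (cong₂ _+_ (k>n⇒nCk≡0 0<k) refl) ⟩
  0 C k + 0 C suc k             ≡⟨ sym (cong (λ m → m C k + m C suc k) (m≤n⇒m∸n≡0 (<⇒≤ n<a))) ⟩
  (n ∸ a) C k + (n ∸ a) C suc k ∎
  where
  open ≡-Reasoning
  n<a : n < a
  n<a = ≰⇒> a≰n
  0<k : 0 < k
  0<k = <-≤-trans (≤-<-trans z≤n n<a) a≤k

count-cap₂ : ∀ b m k → countInv k (layered cap₂ b m) ≡ (m ∸ k) C k
count-cap₂ b zero zero = refl
count-cap₂ b zero (suc k) = refl
count-cap₂ b (suc zero) zero = refl
count-cap₂ b (suc zero) (suc k) = cong (_C suc k) (sym (0∸n≡0 k))
count-cap₂ b (suc (suc m)) zero =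
  trans (countInv-layered cap₂ b (suc m) 0)
        (cong₂ _+_ (count-cap₂ (suc b) (suc m) 0) (countInv-layered₂₊-0 cap₂ b (suc m)))
count-cap₂ b (suc (suc m)) (suc k) = begin
  countInv (suc k) (layered cap₂ b (2 + m))
    ≡⟨ countInv-layered cap₂ b (suc m) (suc k) ⟩
  countInv (suc k) (layered cap₂ (suc b) (suc m)) + countInv (suc k) (layered₂₊ cap₂ b (suc m))
    ≡⟨ cong₂ _+_ (count-cap₂ (suc b) (suc m) (suc k)) (trans (countInv-layered₂₊ cap₂ b m k) (+-identityʳ _)) ⟩
  (m ∸ k) C suc k + countInv k (layered cap₂ (2 + b) m)
    ≡⟨ cong ((m ∸ k) C suc k +_) (count-cap₂ (2 + b) m k) ⟩
  (m ∸ k) C suc k + (m ∸ k) C k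
    ≡⟨ +-comm ((m ∸ k) C suc k) _ ⟩
  (m ∸ k) C k + (m ∸ k) C suc k
    ≡⟨ ∸-Pascal m k k ≤-refl ⟨
  (suc m ∸ k) C suc k ∎
  where open ≡-Reasoning

count-cap₃ : ∀ b m j → countInv (3 + j) (layered cap₃ b m) ≡ (m ∸ (3 + j)) C (3 + j) + (m ∸ (2 + j)) C (1 + j)
count-cap₃ b zero j = refl
count-cap₃ b (suc zero) j = refl
count-cap₃ b (suc (suc zero)) j = begin
  countInv (3 + j) (layered cap₃ b 2)       ≡⟨ countInv-layered cap₃ b 1 (3 + j) ⟩
  countInv (3 + j) (layered₂₊ cap₃ b 1)     ≡⟨ countInv-layered₂₊ cap₃ b 0 (2 + j) ⟩
  0                                         ≡⟨ cong (_C (1 + j)) (0∸n≡0 j) ⟨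
  (0 ∸ j) C (1 + j)                         ∎
  where open ≡-Reasoning
count-cap₃ b (suc (suc (suc m))) j = begin
  countInv (3 + j) (layered cap₃ b (3 + m))
    ≡⟨ countInv-layered cap₃ b (2 + m) (3 + j) ⟩
  countInv (3 + j) (layered cap₃ (suc b) (2 + m)) + countInv (3 + j) (layered₂₊ cap₃ b (2 + m))
    ≡⟨ cong₂ _+_ (count-cap₃ (suc b) (suc (suc m)) j) (countInv-layered₂₊ cap₃ b (suc m) (2 + j)) ⟩
  (A₃ + B₁) + (countInv (2 + j) (layered cap₂ (2 + b) (suc m)) + countInv (3 + j) (layered₃ cap₃ b (suc m)))
    ≡⟨ cong ((A₃ + B₁) +_) (cong₂ _+_ (count-cap₂ (2 + b) (suc m) (2 + j))
                                        (trans (countInv-layered₃ b m j) (count-cap₂ (3 + b) m j))) ⟩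
  (A₃ + B₁) + (A₂ + B₀)
    ≡⟨ solve 4 (λ a₃ b₁ a₂ b₀ → (a₃ :+ b₁) :+ (a₂ :+ b₀) := (a₂ :+ a₃) :+ (b₀ :+ b₁)) refl A₃ B₁ A₂ B₀ ⟩
  (A₂ + A₃) + (B₀ + B₁)
    ≡⟨ cong₂ _+_ (∸-Pascal m (1 + j) (2 + j) (n≤1+n (1 + j))) (∸-Pascal m j j ≤-refl) ⟨
  (m ∸ j) C (3 + j) + (suc m ∸ j) C (1 + j) ∎
  where
  open ≡-Reasoning
  open +-*-Solver
  A₂ A₃ B₀ B₁ : ℕ
  A₂ = (m ∸ (1 + j)) C (2 + j)
  A₃ = (m ∸ (1 + j)) C (3 + j)
  B₀ = (m ∸ j) C j
  B₁ = (m ∸ j) C (1 + j)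

hockey-stick : ∀ j N → sum (map (λ ℓ → (ℓ ∸ j) C j) (filterᵇ (λ ℓ → not (ℓ <ᵇ j)) (upTo N))) ≡ (N ∸ j) C suc j
hockey-stick j zero = cong (_C suc j) (sym (0∸n≡0 j))
hockey-stick j (suc N) = begin
  S (upTo (suc N))             ≡⟨ cong S (upTo-∷ʳ N) ⟨
  S (upTo N ++ N ∷ [])         ≡⟨ S-++ (upTo N) (N ∷ []) ⟩
  S (upTo N) + S (N ∷ [])      ≡⟨ cong (_+ S (N ∷ [])) (hockey-stick j N) ⟩
  (N ∸ j) C suc j + S (N ∷ []) ≡⟨ last-term ⟩
  (suc N ∸ j) C suc j          ∎
  where
  open ≡-Reasoning
  f : ℕ → ℕ
  f ℓ = (ℓ ∸ j) C j
  q : ℕ → Bool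
  q ℓ = not (ℓ <ᵇ j)
  S : List ℕ → ℕ
  S ℓs = sum (map f (filterᵇ q ℓs))
  S-++ : ∀ xs ys → S (xs ++ ys) ≡ S xs + S ys
  S-++ xs ys = trans (cong (sum ∘ map f) (filter-++ (T? ∘ q) xs ys))
                     (trans (cong sum (map-++ f (filterᵇ q xs) _)) (sum-++ (map f (filterᵇ q xs)) _))
  last-term : (N ∸ j) C suc j + S (N ∷ []) ≡ (suc N ∸ j) C suc j
  last-term with N <? j
  ... | yes N<j rewrite filter-reject (T? ∘ q) {N} {[]} (λ t → T-not⁻ t (<⇒<ᵇ N<j))
                      | m≤n⇒m∸n≡0 (<⇒≤ N<j) | m≤n⇒m∸n≡0 N<j = refl
  ... | no N≮j rewrite filter-accept (T? ∘ q) {N} {[]} (≥⇒≮ᵇ (≮⇒≥ N≮j)) =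
    trans (cong ((N ∸ j) C suc j +_) (+-identityʳ (f N))) (trans (+-comm _ (f N)) (sym (∸-Pascal N j j ≤-refl)))

sumToNminus3-closed : ∀ j n → sumToNminus3 j n (λ ℓ → (ℓ ∸ j) C j) ≡ (n ∸ (2 + j)) C (1 + j)
sumToNminus3-closed j n = trans (hockey-stick j (n ∸ 2)) (cong (_C suc j) (∸-+-assoc n 2 j))

theorem3p2 : (n k : ℕ) → 1 ≤ n → k ≥ 3 →
    (countAvInv A₁ n k ≡ (n ∸ k) C k + sumToNminus3 (k ∸ 3) n (λ ℓ → (ℓ ∸ (k ∸ 3)) C (k ∸ 3)))
    × ((n ∸ k) C k + sumToNminus3 (k ∸ 3) n (λ ℓ → (ℓ ∸ (k ∸ 3)) C (k ∸ 3))
        ≡ (n ∸ k) C k + ((n + 1) ∸ k) C (k ∸ 2))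
theorem3p2 n (suc (suc (suc j))) _ (s≤s (s≤s (s≤s _))) = counted , closed
  where
  open ≡-Reasoning
  A : ℕ
  A = (n ∸ (3 + j)) C (3 + j)
  counted : countAvInv A₁ n (3 + j) ≡ A + sumToNminus3 j n (λ ℓ → (ℓ ∸ j) C j)
  counted = begin
    countAvInv A₁ n (3 + j)                       ≡⟨ countAvInv≡countInv n (3 + j) ⟩
    countInv (3 + j) (layered cap₃ 0 n)           ≡⟨ count-cap₃ 0 n j ⟩
    A + (n ∸ (2 + j)) C (1 + j)                   ≡⟨ cong (A +_) (sumToNminus3-closed j n) ⟨
    A + sumToNminus3 j n (λ ℓ → (ℓ ∸ j) C j)      ∎
  closed : A + sumToNminus3 j n (λ ℓ → (ℓ ∸ j) C j) ≡ A + ((n + 1) ∸ (3 + j)) C (1 + j)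
  closed = cong (A +_) (trans (sumToNminus3-closed j n) (cong (λ m → (m ∸ (3 + j)) C (1 + j)) (+-comm 1 n)))
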